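{- Let (Or) $x\lor_s y=\neg(\neg x\land_s\neg y)$, (Abs) $x\land_s(x\lor_s y)=x$, (Mem) $(x\lor_s y)\land_s z=(\neg x\land_s(y\land_s z))\lor_s(x\land_s z)$ and (Comm) $x\land_s y=y\land_s x$. From these four equations the following are derivable in equational logic: $x\land_s x=x$, $x\lor_s x=x$, $(x\land_s y)\land_s z=x\land_s(y\land_s z)$, $(x\lor_s y)\lor_s z=x\lor_s(y\lor_s z)$, $\neg\neg x=x$, (Tdef) $(x\lor_s\neg x)\land_s y=y$, and (LD) $x\land_s(y\lor_s z)=(x\land_s y)\lor_s(x\land_s z)$. Furthermore, if $|A|\ge 2$, these four equations (Or), (Abs), (Mem), (Comm) are independent: none is derivable from the other three.
   Context: $A$ is a non-empty set of atoms; terms are over $\Sigma_{SCL}(A)=\{\land_s,\lor_s,\neg,\mathsf T,\mathsf F\}\cup A$ (atoms and $\mathsf T,\mathsf F$ constants, $\neg$ unary, $\land_s,\lor_s$ binary sequential conjunction/disjunction) with variables. -}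

module Defs where

open import Data.Nat using (ℕ)
open import Data.Product using (_×_; _,_)
open import Data.List using (List; []; _∷_)
open import Data.List.Membership.Propositional using (_∈_)

data Term (A : Set) : Set where
  var  : ℕ → Term A
  atom : A → Term A
  T F  : Term A
  ¬s_  : Term A → Term A
  _∧s_ : Term A → Term A → Term A
  _∨s_ : Term A → Term A → Term A

infix  9 ¬s_
infixr 7 _∧s_
infixr 6 _∨s_

sub : {A : Set} → (ℕ → Term A) → Term A → Term A
sub σ (var n)   = σ n
sub σ (atom a)  = atom a
sub σ T         = T
sub σ F         = F
sub σ (¬s t)    = ¬s (sub σ t)
sub σ (s ∧s t)  = sub σ s ∧s sub σ t
sub σ (s ∨s t)  = sub σ s ∨s sub σ t

Equation : Set → Set
Equation A = Term A × Term A

data _⊢_≈_ {A : Set} (E : List (Equation A)) : Term A → Term A → Set where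
  ax     : ∀ {l r} → (l , r) ∈ E → (σ : ℕ → Term A) → E ⊢ sub σ l ≈ sub σ r
  refl   : ∀ {t} → E ⊢ t ≈ t
  sym    : ∀ {s t} → E ⊢ s ≈ t → E ⊢ t ≈ s
  trans  : ∀ {s t u} → E ⊢ s ≈ t → E ⊢ t ≈ u → E ⊢ s ≈ u
  cong¬  : ∀ {s t} → E ⊢ s ≈ t → E ⊢ ¬s s ≈ ¬s t
  cong∧  : ∀ {s s' t t'} → E ⊢ s ≈ s' → E ⊢ t ≈ t' → E ⊢ (s ∧s t) ≈ (s' ∧s t')
  cong∨  : ∀ {s s' t t'} → E ⊢ s ≈ s' → E ⊢ t ≈ t' → E ⊢ (s ∨s t) ≈ (s' ∨s t')

infix 4 _⊢_≈_

module _ {A : Set} where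
  x y z : Term A
  x = var 0
  y = var 1
  z = var 2

  Or Abs Mem Comm : Equation A
  Or   = (x ∨s y , ¬s (¬s x ∧s ¬s y))
  Abs  = (x ∧s (x ∨s y) , x)
  Mem  = ((x ∨s y) ∧s z , (¬s x ∧s (y ∧s z)) ∨s (x ∧s z))
  Comm = (x ∧s y , y ∧s x)

  EqC : List (Equation A)
  EqC = Or ∷ Abs ∷ Mem ∷ Comm ∷ []

  _⊢_ : List (Equation A) → Equation A → Set
  E ⊢ (l , r) = E ⊢ l ≈ r
  infix 4 _⊢_

-- Everything is derived inside the equational theory EqC.
--   1. From Abs, Mem and Comm alone (Or only rewrites ∨ as ¬(¬_ ∧ ¬_)) we get
--      idempotence of ∧ and the inequalities a ≤ ¬¬a, a ≤ ¬⁴a, which combine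
--      to ¬⁵a = ¬³a.
--   2. Every term is provably a negation (a = a ∨ (¬a ∧ (b ∧ a))), so a law
--      about ¬ⁿ⁺¹ can be "peeled" to a law about ¬ⁿ; three peels turn
--      ¬⁵a = ¬³a into double negation ¬¬a = a.
--   3. With double negation, Mem yields the excluded middle (Tdef), a unique
--      bottom O, relative complements and left distributivity (LD); the dual
--      distributive law then shows that a ∨ _ and ¬a ∨ _ jointly determine a
--      term, which gives associativity of ∧, hence of ∨.  Equational derivations are sound for every interpretation of
-- the connectives, so each axiom is refuted by a small model of the other
-- three.
module Submission where

open import Defs
open import Data.Product using (_×_; _,_; Σ)
open import Data.List using (List; _∷_; [])
open import Data.List.Membership.Propositional using (_∈_)
open import Data.List.Relation.Unary.Any using (here; there)
open import Data.Nat using (ℕ; zero; suc; _+_)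
open import Data.Bool using (Bool; true; false; _∧_; _∨_)
open import Data.Bool.Properties using (∧-abs-∨; ∧-distribʳ-∨; ∨-comm; ∧-comm)
open import Relation.Nullary using (¬_)
open import Relation.Binary.Bundles using (Setoid)
open import Relation.Binary.PropositionalEquality as P using (_≡_; _≢_)
import Relation.Binary.Reasoning.Setoid as SetoidReasoning

module Derivation {A : Set} where

  infix 4 _≃_
  _≃_ : Term A → Term A → Set
  s ≃ t = EqC {A} ⊢ s ≈ t

  ≃-setoid : Setoid _ _
  ≃-setoid = record
    { Carrier = Term A ; _≈_ = _≃_
    ; isEquivalence = record { refl = refl ; sym = sym ; trans = trans } }

  open SetoidReasoning ≃-setoid

  inst : Term A → Term A → Term A → ℕ → Term A
  inst a b c zero          = a
  inst a b c (suc zero)    = b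
  inst a b c (suc (suc _)) = c

  or-def : ∀ a b → a ∨s b ≃ ¬s (¬s a ∧s ¬s b)
  or-def a b = ax (here P.refl) (inst a b T)

  absorb : ∀ a b → a ∧s (a ∨s b) ≃ a
  absorb a b = ax (there (here P.refl)) (inst a b T)

  mem : ∀ a b c → (a ∨s b) ∧s c ≃ (¬s a ∧s (b ∧s c)) ∨s (a ∧s c)
  mem a b c = ax (there (there (here P.refl))) (inst a b c)

  comm : ∀ a b → a ∧s b ≃ b ∧s a
  comm a b = ax (there (there (there (here P.refl)))) (inst a b T)

  comm∨ : ∀ a b → a ∨s b ≃ b ∨s a
  comm∨ a b = begin
    a ∨s b             ≈⟨ or-def a b ⟩
    ¬s (¬s a ∧s ¬s b)  ≈⟨ cong¬ (comm (¬s a) (¬s b)) ⟩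
    ¬s (¬s b ∧s ¬s a)  ≈⟨ or-def b a ⟨
    b ∨s a             ∎

  absorbʳ : ∀ a b → a ∧s (b ∨s a) ≃ a
  absorbʳ a b = trans (cong∧ refl (comm∨ b a)) (absorb a b)

  -- ¬¬a is a join a ∨ w; this is the source of every a ≤ ¬¬a below.
  join-dn : ∀ a b → a ∨s (¬s ¬s a ∧s ¬s b) ≃ ¬s ¬s a
  join-dn a b = begin
    a ∨s (¬s ¬s a ∧s ¬s b)              ≈⟨ or-def a _ ⟩
    ¬s (¬s a ∧s ¬s (¬s ¬s a ∧s ¬s b))   ≈⟨ cong¬ (cong∧ refl (or-def (¬s a) b)) ⟨
    ¬s (¬s a ∧s (¬s a ∨s b))            ≈⟨ cong¬ (absorb (¬s a) b) ⟩
    ¬s ¬s a                             ∎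

  dn-absorbs : ∀ a → ¬s ¬s a ∧s a ≃ a
  dn-absorbs a = trans (comm _ a) (trans (cong∧ refl (sym (join-dn a T))) (absorb a _))

  join-lower : ∀ a b c → (a ∧s b) ∧s ((a ∨s c) ∧s b) ≃ a ∧s b
  join-lower a b c = begin
    (a ∧s b) ∧s ((a ∨s c) ∧s b)                   ≈⟨ cong∧ refl (mem a c b) ⟩
    (a ∧s b) ∧s ((¬s a ∧s (c ∧s b)) ∨s (a ∧s b))  ≈⟨ absorbʳ (a ∧s b) _ ⟩
    a ∧s b                                        ∎

  idem : ∀ a → a ∧s a ≃ a
  idem a = begin
    a ∧s a                                    ≈⟨ cong∧ refl (absorbʳ a (¬s ¬s a)) ⟨
    a ∧s (a ∧s (¬s ¬s a ∨s a))                ≈⟨ cong∧ refl (comm a _) ⟩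
    a ∧s ((¬s ¬s a ∨s a) ∧s a)                ≈⟨ cong∧ (dn-absorbs a) refl ⟨
    (¬s ¬s a ∧s a) ∧s ((¬s ¬s a ∨s a) ∧s a)   ≈⟨ join-lower (¬s ¬s a) a a ⟩
    ¬s ¬s a ∧s a                              ≈⟨ dn-absorbs a ⟩
    a                                         ∎

  join-lower-dn : ∀ a b → (a ∧s b) ∧s (¬s ¬s a ∧s b) ≃ a ∧s b
  join-lower-dn a b =
    trans (cong∧ refl (cong∧ (sym (join-dn a T)) refl)) (join-lower a b _)

  -- a ≤ ¬⁴a, in the only form available before associativity.
  below-dn⁴ : ∀ a → a ∧s (a ∧s ¬s ¬s ¬s ¬s a) ≃ a
  below-dn⁴ a = begin
    a ∧s (a ∧s ¬s ¬s ¬s ¬s a)                  ≈⟨ cong∧ refl (comm a _) ⟩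
    a ∧s (¬s ¬s ¬s ¬s a ∧s a)                  ≈⟨ cong∧ (dn-absorbs a) refl ⟨
    (¬s ¬s a ∧s a) ∧s (¬s ¬s ¬s ¬s a ∧s a)     ≈⟨ join-lower-dn (¬s ¬s a) a ⟩
    ¬s ¬s a ∧s a                               ≈⟨ dn-absorbs a ⟩
    a                                          ∎

  -- A restricted form of ¬¬a ∧ (¬¬a ∧ c) = ¬¬a ∧ c, enough to flatten below-dn⁴.
  dn-lower : ∀ a b → ¬s ¬s a ∧s (¬s ¬s a ∧s ¬s b) ≃ ¬s ¬s a ∧s ¬s b
  dn-lower a b = begin
    ¬s ¬s a ∧s (¬s ¬s a ∧s ¬s b)                    ≈⟨ comm _ _ ⟩
    (¬s ¬s a ∧s ¬s b) ∧s ¬s ¬s a                    ≈⟨ cong∧ refl (join-dn a b) ⟨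
    (¬s ¬s a ∧s ¬s b) ∧s (a ∨s (¬s ¬s a ∧s ¬s b))   ≈⟨ absorbʳ _ a ⟩
    ¬s ¬s a ∧s ¬s b                                 ∎

  neg⁵≃neg³ : ∀ a → ¬s ¬s ¬s ¬s ¬s a ≃ ¬s ¬s ¬s a
  neg⁵≃neg³ a = begin
    ¬s ¬s ¬s ¬s ¬s a                                         ≈⟨ absorbʳ _ (¬s a) ⟨
    ¬s ¬s ¬s ¬s ¬s a ∧s (¬s a ∨s ¬s ¬s ¬s ¬s ¬s a)            ≈⟨ cong∧ refl (or-def _ _) ⟩
    ¬s ¬s ¬s ¬s ¬s a ∧s ¬s (¬s ¬s a ∧s ¬s ¬s ¬s ¬s ¬s ¬s a)   ≈⟨ cong∧ refl (cong¬ dn²≤dn⁶) ⟩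
    ¬s ¬s ¬s ¬s ¬s a ∧s ¬s ¬s ¬s a                            ≈⟨ dn-absorbs (¬s ¬s ¬s a) ⟩
    ¬s ¬s ¬s a                                               ∎
    where
    dn²≤dn⁶ : ¬s ¬s a ∧s ¬s ¬s ¬s ¬s ¬s ¬s a ≃ ¬s ¬s a
    dn²≤dn⁶ = trans (sym (dn-lower a _)) (below-dn⁴ (¬s ¬s a))

  -- Every term absorbs ¬a ∧ (b ∧ a); by Or this exhibits a as a negation.
  represent : ∀ a b → a ≃ a ∨s (¬s a ∧s (b ∧s a))
  represent a b = begin
    a                                   ≈⟨ absorb a b ⟨
    a ∧s (a ∨s b)                       ≈⟨ comm _ _ ⟩
    (a ∨s b) ∧s a                       ≈⟨ mem a b a ⟩
    (¬s a ∧s (b ∧s a)) ∨s (a ∧s a)      ≈⟨ cong∨ refl (idem a) ⟩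
    (¬s a ∧s (b ∧s a)) ∨s a             ≈⟨ comm∨ _ _ ⟩
    a ∨s (¬s a ∧s (b ∧s a))             ∎

  neg^ : ℕ → Term A → Term A
  neg^ zero    t = t
  neg^ (suc n) t = neg^ n (¬s t)

  cong-neg^ : ∀ n {s t} → s ≃ t → neg^ n s ≃ neg^ n t
  cong-neg^ zero    p = p
  cong-neg^ (suc n) p = cong-neg^ n (cong¬ p)

  -- A law ¬ᵏ⁺² = ¬ᵏ holding for all negations holds for all terms.
  peel : ∀ k → (∀ t → neg^ (3 + k) t ≃ neg^ (1 + k) t) → ∀ a → neg^ (2 + k) a ≃ neg^ k a
  peel k law a = begin
    neg^ (2 + k) a   ≈⟨ cong-neg^ (2 + k) a≃¬t ⟩
    neg^ (3 + k) t   ≈⟨ law t ⟩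
    neg^ (1 + k) t   ≈⟨ cong-neg^ k a≃¬t ⟨
    neg^ k a         ∎
    where
    t : Term A
    t = ¬s a ∧s ¬s (¬s a ∧s (T ∧s a))
    a≃¬t : a ≃ ¬s t
    a≃¬t = trans (represent a T) (or-def a _)

  dn : ∀ a → ¬s ¬s a ≃ a
  dn = peel 0 (peel 1 (peel 2 neg⁵≃neg³))

  de-morgan∧ : ∀ a b → ¬s (a ∧s b) ≃ ¬s a ∨s ¬s b
  de-morgan∧ a b = trans (cong¬ (cong∧ (sym (dn a)) (sym (dn b)))) (sym (or-def (¬s a) (¬s b)))

  de-morgan∨ : ∀ a b → ¬s (a ∨s b) ≃ ¬s a ∧s ¬s b
  de-morgan∨ a b = trans (cong¬ (or-def a b)) (dn _)

  or-idem : ∀ a → a ∨s a ≃ a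
  or-idem a = trans (or-def a a) (trans (cong¬ (idem (¬s a))) (dn a))

  absorb-dual : ∀ a b → a ∨s (a ∧s b) ≃ a
  absorb-dual a b = begin
    a ∨s (a ∧s b)                          ≈⟨ or-def a _ ⟩
    ¬s (¬s a ∧s ¬s (a ∧s b))               ≈⟨ cong¬ (cong∧ refl (de-morgan∧ a b)) ⟩
    ¬s (¬s a ∧s (¬s a ∨s ¬s b))            ≈⟨ cong¬ (absorb (¬s a) (¬s b)) ⟩
    ¬s ¬s a                                ≈⟨ dn a ⟩
    a                                      ∎

  lower-left : ∀ a b → a ∧s (a ∧s b) ≃ a ∧s b
  lower-left a b = begin
    a ∧s (a ∧s b)                   ≈⟨ comm _ _ ⟩
    (a ∧s b) ∧s a                   ≈⟨ cong∧ refl (absorb-dual a b) ⟨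
    (a ∧s b) ∧s (a ∨s (a ∧s b))     ≈⟨ absorbʳ _ a ⟩
    a ∧s b                          ∎

  split : ∀ a b → (b ∧s a) ∨s (¬s b ∧s a) ≃ a
  split a b = begin
    (b ∧s a) ∨s (¬s b ∧s a)         ≈⟨ comm∨ _ _ ⟩
    (¬s b ∧s a) ∨s (b ∧s a)         ≈⟨ cong∨ (cong∧ refl (idem a)) refl ⟨
    (¬s b ∧s (a ∧s a)) ∨s (b ∧s a)  ≈⟨ mem b a a ⟨
    (b ∨s a) ∧s a                   ≈⟨ comm _ _ ⟩
    a ∧s (b ∨s a)                   ≈⟨ absorbʳ a b ⟩
    a                               ∎

  tdef : ∀ b a → (b ∨s ¬s b) ∧s a ≃ a
  tdef b a = begin
    (b ∨s ¬s b) ∧s a                      ≈⟨ mem b (¬s b) a ⟩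
    (¬s b ∧s (¬s b ∧s a)) ∨s (b ∧s a)     ≈⟨ cong∨ (lower-left (¬s b) a) refl ⟩
    (¬s b ∧s a) ∨s (b ∧s a)               ≈⟨ comm∨ _ _ ⟩
    (b ∧s a) ∨s (¬s b ∧s a)               ≈⟨ split a b ⟩
    a                                     ∎

  I O : Term A
  I = T ∨s ¬s T
  O = ¬s I

  top-unit : ∀ a → I ∧s a ≃ a
  top-unit = tdef T

  excluded-middle : ∀ a → a ∨s ¬s a ≃ I
  excluded-middle a = begin
    a ∨s ¬s a            ≈⟨ top-unit _ ⟨
    I ∧s (a ∨s ¬s a)     ≈⟨ comm _ _ ⟩
    (a ∨s ¬s a) ∧s I     ≈⟨ tdef a I ⟩
    I                    ∎

  -- ¬a ∧ (b ∧ a) is bottom: its negation w' satisfies ¬a ∧ w' = ¬a and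
  -- a ∧ w' = a, so splitting w' on a gives a ∨ ¬a.
  contradiction : ∀ a b → ¬s a ∧s (b ∧s a) ≃ O
  contradiction a b = trans (sym (dn w)) (cong¬ ¬w≃I)
    where
    w : Term A
    w = ¬s a ∧s (b ∧s a)
    ¬a∧¬w : ¬s a ∧s ¬s w ≃ ¬s a
    ¬a∧¬w = sym (trans (cong¬ (trans (represent a b) (or-def a w))) (dn _))
    a∧¬w : a ∧s ¬s w ≃ a
    a∧¬w = begin
      a ∧s ¬s (¬s a ∧s (b ∧s a))        ≈⟨ cong∧ refl (cong¬ (cong∧ refl (dn _))) ⟨
      a ∧s ¬s (¬s a ∧s ¬s ¬s (b ∧s a))  ≈⟨ cong∧ refl (or-def a _) ⟨
      a ∧s (a ∨s ¬s (b ∧s a))           ≈⟨ absorb a _ ⟩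
      a                                 ∎
    ¬w≃I : ¬s w ≃ I
    ¬w≃I = begin
      ¬s w                                     ≈⟨ tdef a _ ⟨
      (a ∨s ¬s a) ∧s ¬s w                      ≈⟨ mem a (¬s a) _ ⟩
      (¬s a ∧s (¬s a ∧s ¬s w)) ∨s (a ∧s ¬s w)  ≈⟨ cong∨ (lower-left (¬s a) _) a∧¬w ⟩
      (¬s a ∧s ¬s w) ∨s a                      ≈⟨ cong∨ ¬a∧¬w refl ⟩
      ¬s a ∨s a                                ≈⟨ comm∨ _ _ ⟩
      a ∨s ¬s a                                ≈⟨ excluded-middle a ⟩
      I                                        ∎

  noncontradiction : ∀ a → a ∧s ¬s a ≃ O
  noncontradiction a = trans (comm a _) (trans (cong∧ refl (sym (idem a))) (contradiction a a))

  bottom-zero : ∀ a → a ∧s O ≃ O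
  bottom-zero a = begin
    a ∧s O               ≈⟨ cong∧ refl (noncontradiction a) ⟨
    a ∧s (a ∧s ¬s a)     ≈⟨ lower-left a _ ⟩
    a ∧s ¬s a            ≈⟨ noncontradiction a ⟩
    O                    ∎

  bottom-unit : ∀ a → O ∨s a ≃ a
  bottom-unit a = begin
    O ∨s a               ≈⟨ or-def O a ⟩
    ¬s (¬s ¬s I ∧s ¬s a) ≈⟨ cong¬ (cong∧ (dn I) refl) ⟩
    ¬s (I ∧s ¬s a)       ≈⟨ cong¬ (top-unit _) ⟩
    ¬s ¬s a              ≈⟨ dn a ⟩
    a                    ∎

  bottom-unitʳ : ∀ a → a ∨s O ≃ a
  bottom-unitʳ a = trans (comm∨ a O) (bottom-unit a)

  meet-complement : ∀ a b → a ∧s ¬s (a ∧s b) ≃ a ∧s ¬s b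
  meet-complement a b = begin
    a ∧s ¬s (a ∧s b)                          ≈⟨ comm _ _ ⟩
    ¬s (a ∧s b) ∧s a                          ≈⟨ cong∧ (de-morgan∧ a b) refl ⟩
    (¬s a ∨s ¬s b) ∧s a                       ≈⟨ mem (¬s a) (¬s b) a ⟩
    (¬s ¬s a ∧s (¬s b ∧s a)) ∨s (¬s a ∧s a)   ≈⟨ cong∨ (cong∧ (dn a) (comm _ _)) (comm _ _) ⟩
    (a ∧s (a ∧s ¬s b)) ∨s (a ∧s ¬s a)         ≈⟨ cong∨ (lower-left a _) (noncontradiction a) ⟩
    (a ∧s ¬s b) ∨s O                          ≈⟨ bottom-unitʳ _ ⟩
    a ∧s ¬s b                                 ∎

  join-complement : ∀ a b → a ∨s (¬s a ∧s b) ≃ a ∨s b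
  join-complement a b = begin
    a ∨s (¬s a ∧s b)                 ≈⟨ or-def a _ ⟩
    ¬s (¬s a ∧s ¬s (¬s a ∧s b))      ≈⟨ cong¬ (meet-complement (¬s a) b) ⟩
    ¬s (¬s a ∧s ¬s b)                ≈⟨ or-def a b ⟨
    a ∨s b                           ∎

  join-complement⁻ : ∀ a b → ¬s a ∨s (a ∧s b) ≃ ¬s a ∨s b
  join-complement⁻ a b =
    trans (cong∨ refl (cong∧ (sym (dn a)) refl)) (join-complement (¬s a) b)

  mask : ∀ a b c → ¬s (a ∧s c) ∧s (b ∧s c) ≃ ¬s a ∧s (b ∧s c)
  mask a b c = begin
    ¬s (a ∧s c) ∧s (b ∧s c)                                ≈⟨ cong∧ (de-morgan∧ a c) refl ⟩
    (¬s a ∨s ¬s c) ∧s (b ∧s c)                             ≈⟨ mem (¬s a) (¬s c) (b ∧s c) ⟩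
    (¬s ¬s a ∧s (¬s c ∧s (b ∧s c))) ∨s (¬s a ∧s (b ∧s c))  ≈⟨ cong∨ (cong∧ refl (contradiction c b)) refl ⟩
    (¬s ¬s a ∧s O) ∨s (¬s a ∧s (b ∧s c))                   ≈⟨ cong∨ (bottom-zero _) refl ⟩
    O ∨s (¬s a ∧s (b ∧s c))                                ≈⟨ bottom-unit _ ⟩
    ¬s a ∧s (b ∧s c)                                       ∎

  distrib : ∀ a b c → a ∧s (b ∨s c) ≃ (a ∧s b) ∨s (a ∧s c)
  distrib a b c = begin
    a ∧s (b ∨s c)                           ≈⟨ comm _ _ ⟩
    (b ∨s c) ∧s a                           ≈⟨ mem b c a ⟩
    (¬s b ∧s (c ∧s a)) ∨s (b ∧s a)          ≈⟨ comm∨ _ _ ⟩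
    (b ∧s a) ∨s (¬s b ∧s (c ∧s a))          ≈⟨ cong∨ refl (mask b c a) ⟨
    (b ∧s a) ∨s (¬s (b ∧s a) ∧s (c ∧s a))   ≈⟨ join-complement _ _ ⟩
    (b ∧s a) ∨s (c ∧s a)                    ≈⟨ cong∨ (comm b a) (comm c a) ⟩
    (a ∧s b) ∨s (a ∧s c)                    ∎

  distrib-dual : ∀ a b c → a ∨s (b ∧s c) ≃ (a ∨s b) ∧s (a ∨s c)
  distrib-dual a b c = begin
    a ∨s (b ∧s c)                              ≈⟨ or-def _ _ ⟩
    ¬s (¬s a ∧s ¬s (b ∧s c))                   ≈⟨ cong¬ (cong∧ refl (de-morgan∧ b c)) ⟩
    ¬s (¬s a ∧s (¬s b ∨s ¬s c))                ≈⟨ cong¬ (distrib _ _ _) ⟩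
    ¬s ((¬s a ∧s ¬s b) ∨s (¬s a ∧s ¬s c))      ≈⟨ de-morgan∨ _ _ ⟩
    ¬s (¬s a ∧s ¬s b) ∧s ¬s (¬s a ∧s ¬s c)     ≈⟨ cong∧ (or-def a b) (or-def a c) ⟨
    (a ∨s b) ∧s (a ∨s c)                       ∎

  cover : ∀ a w → (a ∨s w) ∧s (¬s a ∨s w) ≃ w
  cover a w = begin
    (a ∨s w) ∧s (¬s a ∨s w)    ≈⟨ cong∧ (comm∨ a w) (comm∨ (¬s a) w) ⟩
    (w ∨s a) ∧s (w ∨s ¬s a)    ≈⟨ distrib-dual w a (¬s a) ⟨
    w ∨s (a ∧s ¬s a)           ≈⟨ cong∨ refl (noncontradiction a) ⟩
    w ∨s O                     ≈⟨ bottom-unitʳ w ⟩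
    w                          ∎

  determined : ∀ a p q → a ∨s p ≃ a ∨s q → ¬s a ∨s p ≃ ¬s a ∨s q → p ≃ q
  determined a p q pos neg = begin
    p                          ≈⟨ cover a p ⟨
    (a ∨s p) ∧s (¬s a ∨s p)    ≈⟨ cong∧ pos neg ⟩
    (a ∨s q) ∧s (¬s a ∨s q)    ≈⟨ cover a q ⟩
    q                          ∎

  -- Both bracketings join with a to a and with ¬a to ¬a ∨ (b ∧ c).
  assoc∧ : ∀ a b c → (a ∧s b) ∧s c ≃ a ∧s (b ∧s c)
  assoc∧ a b c = determined a _ _
    (trans with-a (sym (absorb-dual a _)))
    (trans with-¬a (sym (join-complement⁻ a _)))
    where
    with-a : a ∨s ((a ∧s b) ∧s c) ≃ a
    with-a = begin
      a ∨s ((a ∧s b) ∧s c)           ≈⟨ distrib-dual a _ c ⟩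
      (a ∨s (a ∧s b)) ∧s (a ∨s c)    ≈⟨ cong∧ (absorb-dual a b) refl ⟩
      a ∧s (a ∨s c)                  ≈⟨ absorb a c ⟩
      a                              ∎
    with-¬a : ¬s a ∨s ((a ∧s b) ∧s c) ≃ ¬s a ∨s (b ∧s c)
    with-¬a = begin
      ¬s a ∨s ((a ∧s b) ∧s c)             ≈⟨ distrib-dual (¬s a) _ c ⟩
      (¬s a ∨s (a ∧s b)) ∧s (¬s a ∨s c)   ≈⟨ cong∧ (join-complement⁻ a b) refl ⟩
      (¬s a ∨s b) ∧s (¬s a ∨s c)          ≈⟨ distrib-dual (¬s a) b c ⟨
      ¬s a ∨s (b ∧s c)                    ∎

  assoc∨ : ∀ a b c → (a ∨s b) ∨s c ≃ a ∨s (b ∨s c)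
  assoc∨ a b c = begin
    (a ∨s b) ∨s c                     ≈⟨ or-def _ _ ⟩
    ¬s (¬s (a ∨s b) ∧s ¬s c)          ≈⟨ cong¬ (cong∧ (de-morgan∨ a b) refl) ⟩
    ¬s ((¬s a ∧s ¬s b) ∧s ¬s c)       ≈⟨ cong¬ (assoc∧ _ _ _) ⟩
    ¬s (¬s a ∧s (¬s b ∧s ¬s c))       ≈⟨ cong¬ (cong∧ refl (de-morgan∨ b c)) ⟨
    ¬s (¬s a ∧s ¬s (b ∨s c))          ≈⟨ or-def _ _ ⟨
    a ∨s (b ∨s c)                     ∎

-- An interpretation of the connectives on a carrier; atoms, T and F all
-- denote the same point.
record Interpretation : Set₁ where
  field
    Carrier : Set
    point   : Carrier
    neg     : Carrier → Carrier
    and or  : Carrier → Carrier → Carrier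

-- Interpretations in which ∨ is defined from ∧ by Or (so Or holds trivially).
deMorgan : (D : Set) → D → (D → D) → (D → D → D) → Interpretation
deMorgan D p n a = record
  { Carrier = D ; point = p ; neg = n ; and = a ; or = λ u v → n (a (n u) (n v)) }

module Semantics {A : Set} (M : Interpretation) where
  open Interpretation M

  ⟦_⟧ : Term A → (ℕ → Carrier) → Carrier
  ⟦ var n  ⟧ ρ = ρ n
  ⟦ atom _ ⟧ ρ = point
  ⟦ T      ⟧ ρ = point
  ⟦ F      ⟧ ρ = point
  ⟦ ¬s t   ⟧ ρ = neg (⟦ t ⟧ ρ)
  ⟦ s ∧s t ⟧ ρ = and (⟦ s ⟧ ρ) (⟦ t ⟧ ρ)
  ⟦ s ∨s t ⟧ ρ = or (⟦ s ⟧ ρ) (⟦ t ⟧ ρ)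

  ⟦sub⟧ : ∀ σ t ρ → ⟦ sub σ t ⟧ ρ ≡ ⟦ t ⟧ (λ n → ⟦ σ n ⟧ ρ)
  ⟦sub⟧ σ (var n)  ρ = P.refl
  ⟦sub⟧ σ (atom a) ρ = P.refl
  ⟦sub⟧ σ T        ρ = P.refl
  ⟦sub⟧ σ F        ρ = P.refl
  ⟦sub⟧ σ (¬s t)   ρ = P.cong neg (⟦sub⟧ σ t ρ)
  ⟦sub⟧ σ (s ∧s t) ρ = P.cong₂ and (⟦sub⟧ σ s ρ) (⟦sub⟧ σ t ρ)
  ⟦sub⟧ σ (s ∨s t) ρ = P.cong₂ or (⟦sub⟧ σ s ρ) (⟦sub⟧ σ t ρ)

  Holds : Equation A → Set
  Holds (l , r) = ∀ ρ → ⟦ l ⟧ ρ ≡ ⟦ r ⟧ ρ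

  Satisfies : List (Equation A) → Set
  Satisfies E = ∀ {e} → e ∈ E → Holds e

  sound : ∀ {E s t} → Satisfies E → E ⊢ s ≈ t → Holds (s , t)
  sound ⊨E (ax {l} {r} l≈r∈E σ) ρ =
    P.trans (⟦sub⟧ σ l ρ) (P.trans (⊨E l≈r∈E _) (P.sym (⟦sub⟧ σ r ρ)))
  sound ⊨E refl        ρ = P.refl
  sound ⊨E (sym p)     ρ = P.sym (sound ⊨E p ρ)
  sound ⊨E (trans p q) ρ = P.trans (sound ⊨E p ρ) (sound ⊨E q ρ)
  sound ⊨E (cong¬ p)   ρ = P.cong neg (sound ⊨E p ρ)
  sound ⊨E (cong∧ p q) ρ = P.cong₂ and (sound ⊨E p ρ) (sound ⊨E q ρ)
  sound ⊨E (cong∨ p q) ρ = P.cong₂ or (sound ⊨E p ρ) (sound ⊨E q ρ)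

  underivable : ∀ {E l r} → Satisfies E → (ρ : ℕ → Carrier) → ⟦ l ⟧ ρ ≢ ⟦ r ⟧ ρ → ¬ (E ⊢ (l , r))
  underivable ⊨E ρ l≢r E⊢l≈r = l≢r (sound ⊨E E⊢l≈r ρ)

valuation : {D : Set} → D → D → D → ℕ → D
valuation a b c 0 = a
valuation a b c 1 = b
valuation a b c _ = c

constNeg : Interpretation
constNeg = record { Carrier = Bool ; point = false ; neg = λ _ → true ; and = _∧_ ; or = _∨_ }

collapse : Interpretation
collapse = deMorgan Bool false (λ b → b) (λ _ _ → false)

-- Refutes Mem: strong Kleene three-valued logic.
data Three : Set where
  0ₖ ½ₖ 1ₖ : Three

minₖ : Three → Three → Three
minₖ 0ₖ _  = 0ₖ
minₖ ½ₖ 0ₖ = 0ₖ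
minₖ ½ₖ _  = ½ₖ
minₖ 1ₖ b  = b

notₖ : Three → Three
notₖ 0ₖ = 1ₖ
notₖ ½ₖ = ½ₖ
notₖ 1ₖ = 0ₖ

kleene : Interpretation
kleene = deMorgan Three 0ₖ notₖ minₖ

leftProj : Interpretation
leftProj = deMorgan Bool false (λ b → b) (λ u _ → u)

module Independence {A : Set} where

  no-Or : ¬ ((Abs ∷ Mem ∷ Comm ∷ []) ⊢ Or {A})
  no-Or = underivable ⊨ (valuation false false false) (λ ())
    where
    open Semantics {A} constNeg
    ⊨ : Satisfies (Abs ∷ Mem ∷ Comm ∷ [])
    ⊨ (here P.refl)                 ρ = ∧-abs-∨ (ρ 0) (ρ 1)
    ⊨ (there (here P.refl))         ρ =
      P.trans (∧-distribʳ-∨ (ρ 2) (ρ 0) (ρ 1)) (∨-comm (ρ 0 ∧ ρ 2) (ρ 1 ∧ ρ 2))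
    ⊨ (there (there (here P.refl))) ρ = ∧-comm (ρ 0) (ρ 1)

  no-Abs : ¬ ((Or ∷ Mem ∷ Comm ∷ []) ⊢ Abs {A})
  no-Abs = underivable ⊨ (valuation true false false) (λ ())
    where
    open Semantics {A} collapse
    ⊨ : Satisfies (Or ∷ Mem ∷ Comm ∷ [])
    ⊨ (here P.refl)                 ρ = P.refl
    ⊨ (there (here P.refl))         ρ = P.refl
    ⊨ (there (there (here P.refl))) ρ = P.refl

  no-Mem : ¬ ((Or ∷ Abs ∷ Comm ∷ []) ⊢ Mem {A})
  no-Mem = underivable ⊨ (valuation ½ₖ 1ₖ 1ₖ) (λ ())
    where
    open Semantics {A} kleene
    absorptive : ∀ a b → minₖ a (Interpretation.or kleene a b) ≡ a
    absorptive 0ₖ _  = P.refl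
    absorptive ½ₖ 0ₖ = P.refl
    absorptive ½ₖ ½ₖ = P.refl
    absorptive ½ₖ 1ₖ = P.refl
    absorptive 1ₖ _  = P.refl
    commutative : ∀ a b → minₖ a b ≡ minₖ b a
    commutative 0ₖ 0ₖ = P.refl
    commutative 0ₖ ½ₖ = P.refl
    commutative 0ₖ 1ₖ = P.refl
    commutative ½ₖ 0ₖ = P.refl
    commutative ½ₖ ½ₖ = P.refl
    commutative ½ₖ 1ₖ = P.refl
    commutative 1ₖ 0ₖ = P.refl
    commutative 1ₖ ½ₖ = P.refl
    commutative 1ₖ 1ₖ = P.refl
    ⊨ : Satisfies (Or ∷ Abs ∷ Comm ∷ [])
    ⊨ (here P.refl)                 ρ = P.refl
    ⊨ (there (here P.refl))         ρ = absorptive (ρ 0) (ρ 1)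
    ⊨ (there (there (here P.refl))) ρ = commutative (ρ 0) (ρ 1)

  no-Comm : ¬ ((Or ∷ Abs ∷ Mem ∷ []) ⊢ Comm {A})
  no-Comm = underivable ⊨ (valuation false true false) (λ ())
    where
    open Semantics {A} leftProj
    ⊨ : Satisfies (Or ∷ Abs ∷ Mem ∷ [])
    ⊨ (here P.refl)                 ρ = P.refl
    ⊨ (there (here P.refl))         ρ = P.refl
    ⊨ (there (there (here P.refl))) ρ = P.refl

theorem6p1 : (A : Set) → A →
    (EqC ⊢ (x {A} ∧s x , x)) ×
    (EqC ⊢ (x ∨s x , x {A})) ×
    (EqC ⊢ ((x ∧s y) ∧s z , x ∧s (y ∧s z {A}))) ×
    (EqC ⊢ ((x ∨s y) ∨s z , x ∨s (y ∨s z {A}))) ×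
    (EqC ⊢ (¬s ¬s x , x {A})) ×
    (EqC ⊢ ((x ∨s ¬s x) ∧s y , y {A})) ×
    (EqC ⊢ (x ∧s (y ∨s z) , (x ∧s y) ∨s (x ∧s z {A}))) ×
    ((Σ A λ a → Σ A λ b → a ≢ b) →
      (¬ ((Abs ∷ Mem ∷ Comm ∷ []) ⊢ Or {A})) ×
      (¬ ((Or ∷ Mem ∷ Comm ∷ []) ⊢ Abs {A})) ×
      (¬ ((Or ∷ Abs ∷ Comm ∷ []) ⊢ Mem {A})) ×
      (¬ ((Or ∷ Abs ∷ Mem ∷ []) ⊢ Comm {A})))
theorem6p1 A _ =
  idem x , or-idem x , assoc∧ x y z , assoc∨ x y z , dn x , tdef x y , distrib x y z ,
  λ _ → no-Or , no-Abs , no-Mem , no-Comm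
  where
  open Derivation {A}
  open Independence {A}
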